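{- Let $\mu:G\times H\to K$ be a graph homomorphism, let $g_0g_1$ be an edge of $G$ and $h_0h_1$ an edge of $H$. If every odd-length closed walk in $G$ has an edge $gg'$ such that $\mu(g,h_0)\mu(g',h_0)\in E(K)$ and $\mu(g,h_1)\mu(g',h_1)\in E(K)$, then $G\to K$.
   Context: All graphs are finite, simple, loopless. $G\times H$ is the tensor product (vertices $V(G)\times V(H)$, $(g,h)(g',h')$ an edge iff $gg'\in E(G)$ and $hh'\in E(H)$). $G\to K$ means there is a graph homomorphism from $G$ to $K$. -}

module Defs where

open import Level using (0ℓ)
open import Data.Nat using (ℕ; zero; suc)
open import Data.Nat.Properties using ()
open import Data.Fin using (Fin; toℕ; fromℕ<)
open import Data.Product using (Σ; _×_; _,_; ∃-syntax)
open import Data.Empty using (⊥)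
open import Relation.Nullary using (¬_; Dec)
open import Relation.Binary.PropositionalEquality using (_≡_)
open import Data.Nat.Base using (_%_; _<_)
open import Data.Nat.DivMod using (m%n<n)

record Graph : Set₁ where
  field
    n      : ℕ
    Adj    : Fin n → Fin n → Set
    adj?   : ∀ x y → Dec (Adj x y)
    sym    : ∀ {x y} → Adj x y → Adj y x
    irrefl : ∀ x → ¬ Adj x x

open Graph public

V : Graph → Set
V G = Fin (n G)

IsHom : (G K : Graph) → (V G → V K) → Set
IsHom G K f = ∀ {x y} → Adj G x y → Adj K (f x) (f y)

_⟶_ : Graph → Graph → Set
G ⟶ K = Σ (V G → V K) (IsHom G K)

TVert : Graph → Graph → Set
TVert G H = V G × V H

TAdj : (G H : Graph) → TVert G H → TVert G H → Set
TAdj G H (g , h) (g' , h') = Adj G g g' × Adj H h h'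

IsTensorHom : (G H K : Graph) → (TVert G H → V K) → Set
IsTensorHom G H K μ = ∀ {p q} → TAdj G H p q → Adj K (μ p) (μ q)

next : ∀ {ℓ} → Fin (suc ℓ) → Fin (suc ℓ)
next {ℓ} i = fromℕ< (m%n<n (suc (toℕ i)) (suc ℓ))

data Odd : ℕ → Set where
  one  : Odd 1
  ss   : ∀ {k} → Odd k → Odd (suc (suc k))

-- A closed walk of length suc ℓ in G: vertices w 0, …, w ℓ with
-- w i ~ w (i+1) for i < ℓ and w ℓ ~ w 0.  Its edges are the pairs (w i, w (next i)).
IsClosedWalk : (G : Graph) (ℓ : ℕ) → (Fin (suc ℓ) → V G) → Set
IsClosedWalk G ℓ w = ∀ i → Adj G (w i) (w (next i))

module Submission where

-- Call an edge g g' of G *good* if both layers h₀ and h₁ of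
-- μ map it to an edge of K, i.e. μ(g,h₀) ~ μ(g',h₀) and μ(g,h₁) ~ μ(g',h₁),
-- and *bad* otherwise.  The hypothesis says that every odd closed walk of G
-- contains a good edge, so the graph of bad edges has no odd closed walk and
-- is therefore properly 2-colourable by a parity colouring c.  Then
-- g ↦ μ(g , h_{c g}) is a homomorphism G → K: an edge whose ends get
-- different colours is mapped by μ to the image of an edge of G × H, and an
-- edge whose ends get the same colour is not bad, hence good.

open import Defs
open import Data.Nat as ℕ using (ℕ; zero; suc; _+_; _∸_; _<_; _≤_; z≤n; s≤s; _<?_; parity)
open import Data.Nat.Properties as ℕₚ using ()
open import Data.Nat.Induction using (<-rec)
open import Data.Nat.DivMod using (m%n<n; m<n⇒m%n≡m; n%n≡0)
open import Data.Parity.Base using (Parity; 0ℙ; 1ℙ)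
open import Data.Fin as Fin using (Fin; toℕ; fromℕ<; _≟_)
open import Data.Fin.Properties as Finₚ using (toℕ<n; toℕ-fromℕ<; any?; pigeonhole)
open import Data.Product using (_×_; _,_; ∃; ∃-syntax; proj₁; proj₂)
open import Data.Sum using (_⊎_; inj₁; inj₂)
open import Data.Empty using (⊥; ⊥-elim)
open import Relation.Nullary using (¬_; Dec; yes; no)
open import Relation.Nullary.Decidable using (map′; _×-dec_; ¬?; decidable-stable)
open import Relation.Unary using (Pred; Decidable)
open import Relation.Binary.PropositionalEquality
  using (_≡_; _≢_; refl; trans; cong; subst) renaming (sym to ≡-sym)

least : ∀ {n p} {P : Pred (Fin n) p} → Decidable P → ∃ P →
        ∃ λ i → P i × (∀ j → P j → i Fin.≤ j)
least {suc n} {P = P} P? (i , pi) with P? Fin.zero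
... | yes p₀ = Fin.zero , p₀ , λ _ _ → z≤n
... | no ¬p₀ with i
...   | Fin.zero = ⊥-elim (¬p₀ pi)
...   | Fin.suc i′ with least (λ j → P? (Fin.suc j)) (i′ , pi)
...     | k , pk , k-min = Fin.suc k , pk , minimal
  where
    minimal : ∀ j → P j → Fin.suc k Fin.≤ j
    minimal Fin.zero    p₀ = ⊥-elim (¬p₀ p₀)
    minimal (Fin.suc j) pj = s≤s (k-min j pj)

toℕ-next : ∀ {ℓ} (i : Fin (suc ℓ)) → toℕ (next i) ≡ suc (toℕ i) ℕ.% suc ℓ
toℕ-next {ℓ} i = toℕ-fromℕ< (m%n<n (suc (toℕ i)) (suc ℓ))

next-cases : ∀ {ℓ} (i : Fin (suc ℓ)) →
  (toℕ i < ℓ × toℕ (next i) ≡ suc (toℕ i)) ⊎ (toℕ i ≡ ℓ × toℕ (next i) ≡ 0)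
next-cases {ℓ} i with ℕₚ.m≤n⇒m<n∨m≡n (ℕₚ.≤-pred (toℕ<n i))
... | inj₁ i<ℓ  = inj₁ (i<ℓ , trans (toℕ-next i) (m<n⇒m%n≡m (s≤s i<ℓ)))
... | inj₂ i≡ℓ  = inj₂ (i≡ℓ , trans (toℕ-next i) wrap)
  where
    wrap : suc (toℕ i) ℕ.% suc ℓ ≡ 0
    wrap = subst (λ k → suc k ℕ.% suc ℓ ≡ 0) (≡-sym i≡ℓ) (n%n≡0 (suc ℓ))

-- If a and c have equal parity then a + c + 1 is odd; this is the length
-- of the closed walk formed by two equal-parity walks joined by an edge.
sameParity⇒odd : ∀ a c → parity a ≡ parity c → Odd (suc (a + c))
sameParity⇒odd (suc (suc a)) c             e = ss (sameParity⇒odd a c e)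
sameParity⇒odd 0             0             _ = one
sameParity⇒odd 0             1             ()
sameParity⇒odd 0             (suc (suc c)) e = ss (sameParity⇒odd 0 c e)
sameParity⇒odd 1             0             ()
sameParity⇒odd 1             1             _ = ss one
sameParity⇒odd 1             (suc (suc c)) e = ss (sameParity⇒odd 1 c e)

data Walk (B : Graph) : ℕ → V B → V B → Set where
  []  : ∀ {x} → Walk B 0 x x
  _∷_ : ∀ {m x y z} → Adj B x y → Walk B m y z → Walk B (suc m) x z

infixr 5 _∷_

NoOddClosedWalk : Graph → Set
NoOddClosedWalk B = ∀ ℓ w → Odd (suc ℓ) → IsClosedWalk B ℓ w → ⊥

module Walks (B : Graph) where

  infixr 5 _++_

  _++_ : ∀ {a b x y z} → Walk B a x y → Walk B b y z → Walk B (a + b) x z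
  []      ++ q = q
  (e ∷ p) ++ q = e ∷ (p ++ q)

  _∷ʳ_ : ∀ {m x y z} → Walk B m x y → Adj B y z → Walk B (suc m) x z
  []      ∷ʳ e = e ∷ []
  (d ∷ p) ∷ʳ e = d ∷ (p ∷ʳ e)

  reverse : ∀ {m x z} → Walk B m x z → Walk B m z x
  reverse []      = []
  reverse (e ∷ p) = reverse p ∷ʳ Graph.sym B e

  -- The vertex at position k (positions beyond the end give the endpoint).
  _at_ : ∀ {m x z} → Walk B m x z → ℕ → V B
  _at_ {x = x} _  zero    = x
  _at_ {x = x} [] (suc k) = x
  (_ ∷ p) at suc k        = p at k

  at-end : ∀ {m x z} (p : Walk B m x z) → p at m ≡ z
  at-end []      = refl
  at-end (_ ∷ p) = at-end p

  at-step : ∀ {m x z} (p : Walk B m x z) k → k < m → Adj B (p at k) (p at suc k)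
  at-step (e ∷ _) zero    _         = e
  at-step (_ ∷ p) (suc k) (s≤s k<m) = at-step p k k<m

  take : ∀ {m x z} (p : Walk B m x z) k → k ≤ m → Walk B k x (p at k)
  take _       zero    _         = []
  take (e ∷ p) (suc k) (s≤s k≤m) = e ∷ take p k k≤m

  drop : ∀ {m x z} (p : Walk B m x z) k → k ≤ m → Walk B (m ∸ k) (p at k) z
  drop p       zero    _         = p
  drop (_ ∷ p) (suc k) (s≤s k≤m) = drop p k k≤m

  closedWalk : ∀ {ℓ x} (p : Walk B (suc ℓ) x x) → IsClosedWalk B ℓ (λ i → p at toℕ i)
  closedWalk {ℓ} p i with next-cases i
  ... | inj₁ (i<ℓ , next≡) rewrite next≡ = at-step p (toℕ i) (ℕₚ.m<n⇒m<1+n i<ℓ)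
  ... | inj₂ (i≡ℓ , next≡) rewrite next≡ =
    subst (Adj B (p at toℕ i)) (trans (cong (λ k → p at suc k) i≡ℓ) (at-end p))
          (at-step p (toℕ i) (s≤s (ℕₚ.≤-reflexive i≡ℓ)))

  -- A walk with at least as many steps as vertices repeats a vertex
  -- (pigeonhole); cutting out the loop between the repetitions shortens it.
  cutLoop : ∀ {m x z} → n B ≤ m → Walk B m x z → ∃ λ k → k < m × Walk B k x z
  cutLoop {m} {z = z} n≤m p with pigeonhole (s≤s n≤m) (λ i → p at toℕ i)
  ... | i , j , i<j , same =
    toℕ i + (m ∸ toℕ j) , shorter ,
    take p (toℕ i) i≤m ++ subst (λ v → Walk B (m ∸ toℕ j) v z) (≡-sym same) (drop p (toℕ j) j≤m)
    where
      j≤m : toℕ j ≤ m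
      j≤m = ℕₚ.≤-pred (toℕ<n j)
      i≤m : toℕ i ≤ m
      i≤m = ℕₚ.≤-trans (ℕₚ.<⇒≤ i<j) j≤m
      shorter : toℕ i + (m ∸ toℕ j) < m
      shorter = subst (toℕ i + (m ∸ toℕ j) <_) (ℕₚ.m+[n∸m]≡n j≤m) (ℕₚ.+-monoˡ-< (m ∸ toℕ j) i<j)

  ShortWalk : V B → V B → Set
  ShortWalk x z = ∃ λ k → k < n B × Walk B k x z

  shorten : ∀ {m x z} → Walk B m x z → ShortWalk x z
  shorten {m} = <-rec (λ m → ∀ {x z} → Walk B m x z → ShortWalk x z) go m
    where
      go : ∀ m → (∀ {k} → k < m → ∀ {x z} → Walk B k x z → ShortWalk x z) →
           ∀ {x z} → Walk B m x z → ShortWalk x z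
      go m shorter p with m <? n B
      ... | yes m<n = m , m<n , p
      ... | no m≮n with cutLoop (ℕₚ.≮⇒≥ m≮n) p
      ...   | k , k<m , p′ = shorter k<m p′

  walk? : ∀ k x y → Dec (Walk B k x y)
  walk? zero    x y = map′ (λ { refl → [] }) (λ { [] → refl }) (x ≟ y)
  walk? (suc k) x y =
    map′ (λ (_ , e , p) → e ∷ p) (λ { (e ∷ p) → _ , e , p })
         (any? (λ z → adj? B x z ×-dec walk? k z y))

  Reach : V B → V B → Set
  Reach x y = ∃ λ k → Walk B k x y

  -- Reachability is decidable: it suffices to search walks of length < n.
  reach? : ∀ x y → Dec (Reach x y)
  reach? x y = map′ (λ (k , p) → toℕ k , p) bounded (any? (λ k → walk? (toℕ k) x y))
    where
      bounded : Reach x y → ∃ λ (k : Fin (n B)) → Walk B (toℕ k) x y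
      bounded (_ , p) with shorten p
      ... | k , k<n , q = fromℕ< k<n , subst (λ j → Walk B j x y) (≡-sym (toℕ-fromℕ< k<n)) q

-- The root of a
-- vertex is the least vertex reachable from it, so adjacent vertices share
-- a root; a vertex is coloured by the parity of a walk from its root.
module TwoColouring (B : Graph) (noOdd : NoOddClosedWalk B) where
  open Walks B

  root : V B → V B
  root g = proj₁ (least (reach? g) (g , 0 , []))

  root-reach : ∀ g → Reach g (root g)
  root-reach g = proj₁ (proj₂ (least (reach? g) (g , 0 , [])))

  root-min : ∀ g x → Reach g x → root g Fin.≤ x
  root-min g = proj₂ (proj₂ (least (reach? g) (g , 0 , [])))

  -- Adjacent vertices reach the same vertices, hence have the same root.
  root-edge : ∀ {g g′} → Adj B g g′ → root g ≡ root g′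
  root-edge {g} {g′} e = Finₚ.≤-antisym
    (root-min g (root g′) (extend e (root-reach g′)))
    (root-min g′ (root g) (extend (Graph.sym B e) (root-reach g)))
    where
      extend : ∀ {x y z} → Adj B x y → Reach y z → Reach x z
      extend d (k , p) = suc k , d ∷ p

  fromRoot : ∀ g → Reach (root g) g
  fromRoot g = let (k , p) = root-reach g in k , reverse p

  colour : V B → Parity
  colour g = parity (proj₁ (fromRoot g))

  -- Two walks of equal parity from a common vertex to the ends of an edge
  -- close up into an odd closed walk.
  oddCycle : ∀ {a c r g g′} → Walk B a r g → Adj B g g′ → Walk B c r g′ →
             parity a ≡ parity c → ⊥
  oddCycle {a} {c} p e q same =
    noOdd (a + c) _ (sameParity⇒odd a c same) (closedWalk ((p ∷ʳ e) ++ reverse q))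

  proper : ∀ {g g′} → Adj B g g′ → colour g ≢ colour g′
  proper {g} {g′} e = oddCycle (proj₂ (fromRoot g)) e toG′
    where
      toG′ : Walk B (proj₁ (fromRoot g′)) (root g) g′
      toG′ = subst (λ r → Walk B (proj₁ (fromRoot g′)) r g′) (≡-sym (root-edge e)) (proj₂ (fromRoot g′))

module Layers (G H K : Graph) (μ : TVert G H → V K) (hom : IsTensorHom G H K μ)
              (h₀ h₁ : V H) (h₀h₁ : Adj H h₀ h₁) where

  Good : V G → V G → Set
  Good x y = Adj K (μ (x , h₀)) (μ (y , h₀)) × Adj K (μ (x , h₁)) (μ (y , h₁))

  good? : ∀ x y → Dec (Good x y)
  good? x y = adj? K (μ (x , h₀)) (μ (y , h₀)) ×-dec adj? K (μ (x , h₁)) (μ (y , h₁))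

  badGraph : Graph
  badGraph = record
    { n      = n G
    ; Adj    = λ x y → Adj G x y × ¬ Good x y
    ; adj?   = λ x y → adj? G x y ×-dec ¬? (good? x y)
    ; sym    = λ (e , bad) → Graph.sym G e , λ (k₀ , k₁) → bad (Graph.sym K k₀ , Graph.sym K k₁)
    ; irrefl = λ x (e , _) → irrefl G x e
    }

  layer : Parity → V H
  layer 0ℙ = h₀
  layer 1ℙ = h₁

  layeredHom : (c : V G → Parity) → (∀ {x y} → Adj badGraph x y → c x ≢ c y) → G ⟶ K
  layeredHom c proper = (λ g → μ (g , layer (c g))) , preserves
    where
      good : ∀ {x y} → Adj G x y → c x ≡ c y → Good x y
      good {x} {y} e same = decidable-stable (good? x y) (λ bad → proper (e , bad) same)

      preserves : ∀ {x y} → Adj G x y → Adj K (μ (x , layer (c x))) (μ (y , layer (c y)))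
      preserves {x} {y} e with c x in cx | c y in cy
      ... | 0ℙ | 1ℙ = hom (e , h₀h₁)
      ... | 1ℙ | 0ℙ = hom (e , Graph.sym H h₀h₁)
      ... | 0ℙ | 0ℙ = proj₁ (good e (trans cx (≡-sym cy)))
      ... | 1ℙ | 1ℙ = proj₂ (good e (trans cx (≡-sym cy)))

lemma12 : (G H K : Graph) (μ : TVert G H → V K) → IsTensorHom G H K μ →
    (g₀ g₁ : V G) → Adj G g₀ g₁ → (h₀ h₁ : V H) → Adj H h₀ h₁ →
    (∀ (ℓ : ℕ) (w : Fin (suc ℓ) → V G) → Odd (suc ℓ) → IsClosedWalk G ℓ w →
      ∃[ i ] (Adj K (μ (w i , h₀)) (μ (w (next i) , h₀))
            × Adj K (μ (w i , h₁)) (μ (w (next i) , h₁)))) →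
    G ⟶ K
lemma12 G H K μ hom _ _ _ h₀ h₁ h₀h₁ oddHasGood =
  layeredHom colour proper
  where
    open Layers G H K μ hom h₀ h₁ h₀h₁

    -- An odd closed walk of bad edges would contain a good edge.
    noOddBad : NoOddClosedWalk badGraph
    noOddBad ℓ w odd closed with oddHasGood ℓ w odd (λ i → proj₁ (closed i))
    ... | i , good = proj₂ (closed i) good

    open TwoColouring badGraph noOddBad using (colour; proper)
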